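{- (1) The sequence $(\mathrm{Int}_n : NC^{\mathrm{(mton)}}_2(2n)\to\mathbb{R})_{n\ge1}$, where $\mathrm{Int}_n(\pi,u)$ is the number of interval pairs of $\pi$, is pair-recursive of the second kind with input $(0,1;0)$. (2) The sequence $(\mathrm{Out}_n : NC^{\mathrm{(mton)}}_2(2n)\to\mathbb{R})_{n\ge1}$, where $\mathrm{Out}_n(\pi,u)$ is the number of outer pairs of $\pi$, is pair-recursive of the second kind with input $(1,0;1)$.
   Context: $NC_2(2n)$: non-crossing pair-partitions of $\{1,\ldots,2n\}$. For blocks $V,W$, "$V$ nested inside $W$" means $\min V>\min W$ and $\max V<\max W$. A pair $V\in\pi$ is outer if it is nested inside no other pair of $\pi$, and is an interval pair if $V=\{m,m+1\}$ for some $m$. A monotonic ordering of $\pi\in NC_2(2n)$ is a bijection $u:\pi\to\{1,\ldots,n\}$ with $u(V)>u(W)$ whenever $V$ is nested inside $W$; $NC^{\mathrm{(mton)}}_2(2n)$ is the set of such pairs $(\pi,u)$. $J(\pi,u):=u^{ -1}(n)$, of the form $\{m,m+1\}$. For $n\ge2$ the pair-parent $\mathfrak{pp}(\pi,u)=(\rho,v)\in NC^{\mathrm{(mton)}}_2(2n-2)$: with $J(\pi,u)=\{m,m+1\}$ and $\phi$ the increasing bijection from $\{1,\ldots,2n-2\}$ onto $\{1,\ldots,2n\}\setminus\{m,m+1\}$, $\rho=\{\{p,q'\} : \{\phi(p),\phi(q')\}\in\pi\}$ and $v(\{p,q'\}) = u(\{\phi(p),\phi(q')\})$. $C^{(\mathrm{pair})}(\rho,v)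 := \{(\pi,u) : \mathfrak{pp}(\pi,u)=(\rho,v)\}$. A sequence $(Z_n)$ is pair-recursive of the second kind with input $(\alpha,\beta;q)$ if for every $n\ge2$ and $(\rho,v)\in NC^{\mathrm{(mton)}}_2(2n-2)$ there is $C^{(\mathrm{pair})}_o(\rho,v)\subseteq C^{(\mathrm{pair})}(\rho,v)$ with $Z_n(\pi,u)=Z_{n-1}(\rho,v)+\alpha$ on $C^{(\mathrm{pair})}_o(\rho,v)$, $Z_n(\pi,u)=Z_{n-1}(\rho,v)+\beta$ on its complement in $C^{(\mathrm{pair})}(\rho,v)$, and $|C^{(\mathrm{pair})}_o(\rho,v)|=Z_{n-1}(\rho,v)+q$. -}

module Defs where

open import Data.Nat using (ℕ; zero; suc; _+_; _*_; _∸_; _<ᵇ_; _≤ᵇ_; _≡ᵇ_)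
open import Data.Bool using (Bool; true; false; _∧_; _∨_; not; T; if_then_else_)
open import Data.Product using (Σ; Σ-syntax; _×_; _,_; proj₁; proj₂)
open import Data.Fin using (Fin; toℕ)
open import Data.Vec using (Vec; lookup; toList; init; last; map)
open import Data.List as L using (List; allFin; length; upTo)
open import Data.Bool.ListAction using (all; any)
open import Data.List.Relation.Unary.All using (All)
open import Data.List.Relation.Unary.Unique.Propositional using (Unique)
open import Data.List.Membership.Propositional using (_∉_)
open import Relation.Binary.PropositionalEquality using (_≡_)

-- A block (pair) {a,b} is stored as (a , b) with a < b.  Points are 1,…,2n.
Block : Set
Block = ℕ × ℕ

countᵇ : {A : Set} → (A → Bool) → List A → ℕ
countᵇ p L.[] = 0
countᵇ p (x L.∷ xs) = (if p x then 1 else 0) + countᵇ p xs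

points : ℕ → List ℕ
points n = L.map suc (upTo (2 * n))

wellFormedBlock : ℕ → Block → Bool
wellFormedBlock n (a , b) = (1 ≤ᵇ a) ∧ (a <ᵇ b) ∧ (b ≤ᵇ 2 * n)

containsᵇ : ℕ → Block → Bool
containsᵇ x (a , b) = (x ≡ᵇ a) ∨ (x ≡ᵇ b)

nestedᵇ : Block → Block → Bool
nestedᵇ (a , b) (c , d) = (c <ᵇ a) ∧ (b <ᵇ d)

crossingᵇ : Block → Block → Bool
crossingᵇ (a , b) (c , d) =
  ((a <ᵇ c) ∧ (c <ᵇ b) ∧ (b <ᵇ d)) ∨ ((c <ᵇ a) ∧ (a <ᵇ d) ∧ (d <ᵇ b))

-- A pair (π , u) with π ∈ NC₂(2n) and u a monotonic ordering is encoded as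
-- the vector (u⁻¹(1), …, u⁻¹(n)) of blocks: position i (0-based) has u-value i+1.
validᵇ : (n : ℕ) → Vec Block n → Bool
validᵇ n bs =
  all (wellFormedBlock n) (toList bs)
  ∧ all (λ x → countᵇ (containsᵇ x) (toList bs) ≡ᵇ 1) (points n)
  ∧ all (λ i → all (λ j → not (crossingᵇ (lookup bs i) (lookup bs j))) (allFin n)) (allFin n)
  ∧ all (λ i → all (λ j → not (nestedᵇ (lookup bs i) (lookup bs j)) ∨ (toℕ j <ᵇ toℕ i))
                   (allFin n)) (allFin n)

NCmton : ℕ → Set
NCmton n = Σ[ bs ∈ Vec Block n ] T (validᵇ n bs)

-- φ⁻¹ : the increasing bijection {1..2n} ∖ J → {1..2n-2}, where J = (a , b)
relabel : Block → ℕ → ℕ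
relabel (a , b) x = (x ∸ (if a <ᵇ x then 1 else 0)) ∸ (if b <ᵇ x then 1 else 0)

relabelBlock : Block → Block → Block
relabelBlock J (p , q) = (relabel J p , relabel J q)

-- pair-parent on the encoding: J(π,u) = u⁻¹(n) is the last block; remove it,
-- keep the order (v = u on the remaining blocks) and relabel points via φ⁻¹.
pairParent : {k : ℕ} → NCmton (suc (suc k)) → Vec Block (suc k)
pairParent (bs , _) = map (relabelBlock (last bs)) (init bs)

Int : (n : ℕ) → NCmton n → ℕ
Int n (bs , _) = countᵇ (λ { (a , b) → b ≡ᵇ suc a }) (toList bs)

Out : (n : ℕ) → NCmton n → ℕ
Out n (bs , _) =
  countᵇ (λ V → not (any (λ W → nestedᵇ V W) (toList bs))) (toList bs)

-- Pair-recursive of the second kind with input (α, β; q), for a sequence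
-- (Z_n)_{n ≥ 1} (values of Z at n = 0 are irrelevant).  For n = k+2 ≥ 2 and
-- (ρ,v) ∈ NC₂^(mton)(2n-2), the subset C_o(ρ,v) is given as a duplicate-free
-- list Co, whose length is its cardinality.
PairRecursive2 : (Z : (n : ℕ) → NCmton n → ℕ) → ℕ → ℕ → ℕ → Set
PairRecursive2 Z α β q =
  (k : ℕ) (ρ : NCmton (suc k)) →
  Σ[ Co ∈ List (NCmton (suc (suc k))) ]
    ( Unique Co
    × All (λ x → pairParent x ≡ proj₁ ρ) Co
    × All (λ x → Z (suc (suc k)) x ≡ Z (suc k) ρ + α) Co
    × ((x : NCmton (suc (suc k))) → pairParent x ≡ proj₁ ρ → x ∉ Co →
         Z (suc (suc k)) x ≡ Z (suc k) ρ + β)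
    × length Co ≡ Z (suc k) ρ + q )

{-# OPTIONS --safe #-}

-- For ρ ∈ NC₂^(mton)(2n), the children of ρ are obtained by opening a gap at a position
-- m ∈ {1, …, 2n + 1} and putting the new pair {m, m + 1} there as the block of largest
-- u-value.  Conversely every element of NC₂^(mton)(2n + 2) arises in this way from its
-- pair-parent: no block can be nested inside the block J with largest u-value, and in a
-- non-crossing pair partition this forces J to be an interval pair.  So C^(pair)(ρ) is
-- indexed by the gap m, and both statistics are read off from m.
--   Int: the new pair is an interval pair, and it breaks the interval pair of ρ into which
--   it is inserted, if any; so Int grows by 0 at the Int(ρ) gaps inside interval pairs and
--   by 1 at every other gap.
--   Out: the old pairs keep their status, and the new pair is outer iff the gap lies inside
--   no pair of ρ, which happens exactly for m = 1 and for the gaps just right of the Out(ρ)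
--   outer pairs; so Out grows by 1 at these Out(ρ) + 1 gaps and by 0 elsewhere.

module Submission where

open import Defs
open import Data.Bool using (Bool; true; false; _∧_; _∨_; not; T; if_then_else_)
open import Data.Bool.Properties
  using (T-≡; T-not-≡; T-∧; T-∨; T-irrelevant; ∧-identityʳ; ∧-zeroʳ; ∨-identityʳ; ∨-assoc)
open import Data.Empty using (⊥; ⊥-elim)
open import Data.Fin using (Fin; zero; suc; toℕ)
open import Data.Fin.Properties using (toℕ-injective)
open import Data.List as List using (List; []; _∷_; _++_; [_]; length; filter; allFin)
open import Data.List.Properties using (length-map)
open import Data.Bool.ListAction using (all; any)
open import Data.List.Membership.Propositional using (_∈_; _∉_; find; lose)
open import Data.List.Membership.Propositional.Properties
  using (∈-map⁺; ∈-map⁻; ∈-upTo⁺; ∈-upTo⁻; ∈-allFin; ∈-++⁺ʳ; ∈-++⁻; ∈-filter⁺; ∈-filter⁻)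
open import Data.List.Relation.Unary.All as All using (All; []; _∷_)
open import Data.List.Relation.Unary.All.Properties as Allₚ using (all⁺; all⁻)
open import Data.List.Relation.Unary.AllPairs as AllPairs using (AllPairs; []; _∷_)
import Data.List.Relation.Unary.AllPairs.Properties as AllPairsₚ
open import Data.List.Relation.Unary.Any using (here; there)
open import Data.List.Relation.Unary.Any.Properties using (any⁺; any⁻)
open import Data.List.Relation.Unary.Unique.Propositional using (Unique)
open import Data.Nat using (ℕ; zero; suc; _+_; _*_; _<ᵇ_; _≡ᵇ_; _<_; _≤_; z≤n; s≤s; _≟_; _<?_)
open import Data.Nat.Properties
open import Data.Product using (Σ-syntax; ∃-syntax; _×_; _,_; proj₁; proj₂)
open import Data.Sum as Sum using (_⊎_; inj₁; inj₂; [_,_]′)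
open import Data.Vec as Vec using (Vec; _∷ʳ_; toList; lookup; last; initLast)
open import Data.Vec.Properties using (toList-∷ʳ; toList-map; init-∷ʳ; last-∷ʳ; map-∘; map-cong; map-id)
open import Function using (id; _∘_; _⇔_; Equivalence; mk⇔)
open import Relation.Binary.Definitions using (tri<; tri≈; tri>)
open import Relation.Binary.PropositionalEquality
  using (_≡_; _≢_; refl; sym; trans; cong; cong₂; subst; subst₂; module ≡-Reasoning)
open import Relation.Nullary using (¬_; yes; no)
open import Relation.Nullary.Decidable using (T?)
open import Relation.Nullary.Reflects using (ofʸ)

open Equivalence using (to; from)

<ᵇ≡true : ∀ {a c} → a < c → (a <ᵇ c) ≡ true
<ᵇ≡true = to T-≡ ∘ <⇒<ᵇ

<ᵇ≡false : ∀ {a c} → c ≤ a → (a <ᵇ c) ≡ false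
<ᵇ≡false {a} {c} c≤a with a <ᵇ c | <ᵇ-reflects-< a c
... | true  | ofʸ a<c = ⊥-elim (<⇒≱ a<c c≤a)
... | false | _       = refl

≡ᵇ-refl : ∀ a → (a ≡ᵇ a) ≡ true
≡ᵇ-refl a = to T-≡ (≡⇒≡ᵇ a a refl)

≡ᵇ≡false : ∀ {a c} → a ≢ c → (a ≡ᵇ c) ≡ false
≡ᵇ≡false {a} {c} a≢c with a ≡ᵇ c in eq
... | true  = ⊥-elim (a≢c (≡ᵇ⇒≡ a c (from T-≡ eq)))
... | false = refl

containsᵇ⇔ : ∀ z a b → T (containsᵇ z (a , b)) ⇔ (z ≡ a ⊎ z ≡ b)
containsᵇ⇔ z a b = mk⇔
  (λ t → Sum.map (≡ᵇ⇒≡ z a) (≡ᵇ⇒≡ z b) (to T-∨ t))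
  (λ e → from T-∨ (Sum.map (≡⇒≡ᵇ z a) (≡⇒≡ᵇ z b) e))

T-not⇔ : ∀ {b} → T (not b) ⇔ (¬ T b)
T-not⇔ {true}  = mk⇔ (λ ()) (λ ¬t → ¬t _)
T-not⇔ {false} = mk⇔ (λ _ ()) (λ _ → _)

T-not-∨⇔ : ∀ {b c} → T (not b ∨ c) ⇔ (T b → T c)
T-not-∨⇔ {true}  = mk⇔ (λ t _ → t) (λ f → f _)
T-not-∨⇔ {false} = mk⇔ (λ _ ()) (λ _ → _)

module _ {A : Set} where

  countᵇ-++ : ∀ (p : A → Bool) xs ys → countᵇ p (xs ++ ys) ≡ countᵇ p xs + countᵇ p ys
  countᵇ-++ p []       ys = refl
  countᵇ-++ p (x ∷ xs) ys = trans (cong (_ +_) (countᵇ-++ p xs ys)) (sym (+-assoc (if p x then 1 else 0) _ _))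

  countᵇ-map : ∀ {B : Set} (p : B → Bool) (f : A → B) xs → countᵇ p (List.map f xs) ≡ countᵇ (p ∘ f) xs
  countᵇ-map p f []       = refl
  countᵇ-map p f (x ∷ xs) = cong (_ +_) (countᵇ-map p f xs)

  countᵇ-cong : ∀ {p q : A → Bool} xs → (∀ {x} → x ∈ xs → p x ≡ q x) → countᵇ p xs ≡ countᵇ q xs
  countᵇ-cong []       p≗q = refl
  countᵇ-cong (x ∷ xs) p≗q =
    cong₂ (λ b n → (if b then 1 else 0) + n) (p≗q (here refl)) (countᵇ-cong xs (p≗q ∘ there))

  countᵇ-split : ∀ (p q : A → Bool) xs →
    countᵇ p xs ≡ countᵇ (λ x → p x ∧ q x) xs + countᵇ (λ x → p x ∧ not (q x)) xs
  countᵇ-split p q [] = refl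
  countᵇ-split p q (x ∷ xs) with p x | q x
  ... | true  | true  = cong suc (countᵇ-split p q xs)
  ... | true  | false = trans (cong suc (countᵇ-split p q xs)) (sym (+-suc _ _))
  ... | false | _     = countᵇ-split p q xs

  countᵇ-mono : ∀ {p q : A → Bool} xs → (∀ {x} → x ∈ xs → T (p x) → T (q x)) →
                countᵇ p xs ≤ countᵇ q xs
  countᵇ-mono []       p⇒q = z≤n
  countᵇ-mono {p} {q} (x ∷ xs) p⇒q with p x in px | q x in qx
  ... | true  | true  = s≤s (countᵇ-mono xs (p⇒q ∘ there))
  ... | true  | false = ⊥-elim (subst T qx (p⇒q (here refl) (from T-≡ px)))
  ... | false | true  = m≤n⇒m≤1+n (countᵇ-mono xs (p⇒q ∘ there))
  ... | false | false = countᵇ-mono xs (p⇒q ∘ there)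

  countᵇ≡length-filter : ∀ (p : A → Bool) xs → countᵇ p xs ≡ length (filter (T? ∘ p) xs)
  countᵇ≡length-filter p []       = refl
  countᵇ≡length-filter p (x ∷ xs) with p x
  ... | true  = cong suc (countᵇ≡length-filter p xs)
  ... | false = countᵇ≡length-filter p xs

  ∈⇒countᵇ-pos : ∀ (p : A → Bool) {x} xs → x ∈ xs → T (p x) → 1 ≤ countᵇ p xs
  ∈⇒countᵇ-pos p (y ∷ ys) (here refl) px rewrite to T-≡ px = s≤s z≤n
  ∈⇒countᵇ-pos p (y ∷ ys) (there x∈) px = ≤-trans (∈⇒countᵇ-pos p ys x∈ px) (m≤n+m _ _)

  countᵇ-pos⇒∈ : ∀ (p : A → Bool) xs → 1 ≤ countᵇ p xs → ∃[ x ] (x ∈ xs × T (p x))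
  countᵇ-pos⇒∈ p (y ∷ ys) pos with p y in py
  ... | true  = y , here refl , from T-≡ py
  ... | false = let x , x∈ , px = countᵇ-pos⇒∈ p ys pos in x , there x∈ , px

  countᵇ-none : ∀ (p : A → Bool) xs → (∀ {x} → x ∈ xs → ¬ T (p x)) → countᵇ p xs ≡ 0
  countᵇ-none p []       ¬p = refl
  countᵇ-none p (x ∷ xs) ¬p rewrite to T-not-≡ (from T-not⇔ (¬p (here refl))) = countᵇ-none p xs (¬p ∘ there)

  countᵇ≤1-head : ∀ (p : A → Bool) {x y} xs → T (p x) → countᵇ p (x ∷ xs) ≤ 1 → y ∈ xs → ¬ T (p y)
  countᵇ≤1-head p {x} xs px c≤1 y∈ py rewrite to T-≡ px =
    <⇒≱ (s≤s (∈⇒countᵇ-pos p xs y∈ py)) c≤1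

  countᵇ≤1⇒≡ : ∀ (p : A → Bool) {x y} xs → countᵇ p xs ≤ 1 →
               x ∈ xs → y ∈ xs → T (p x) → T (p y) → x ≡ y
  countᵇ≤1⇒≡ p (z ∷ zs) c≤1 (here refl) (here refl) px py = refl
  countᵇ≤1⇒≡ p (z ∷ zs) c≤1 (here refl) (there y∈) px py = ⊥-elim (countᵇ≤1-head p zs px c≤1 y∈ py)
  countᵇ≤1⇒≡ p (z ∷ zs) c≤1 (there x∈) (here refl) px py = ⊥-elim (countᵇ≤1-head p zs py c≤1 x∈ px)
  countᵇ≤1⇒≡ p (z ∷ zs) c≤1 (there x∈) (there y∈) px py =
    countᵇ≤1⇒≡ p zs (≤-trans (m≤n+m _ (if p z then 1 else 0)) c≤1) x∈ y∈ px py

T-all⇔ : ∀ {A : Set} {p : A → Bool} xs → T (all p xs) ⇔ (∀ {x} → x ∈ xs → T (p x))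
T-all⇔ {p = p} xs = mk⇔ (All.lookup ∘ all⁺ p xs) (all⁻ p ∘ All.tabulate)

T-all-allFin²⇔ : ∀ {n} (r : Fin n → Fin n → Bool) →
  T (all (λ i → all (r i) (allFin n)) (allFin n)) ⇔ (∀ i j → T (r i j))
T-all-allFin²⇔ {n} r = mk⇔
  (λ t i j → to (T-all⇔ (allFin n)) (to (T-all⇔ (allFin n)) t (∈-allFin i)) (∈-allFin j))
  (λ f → from (T-all⇔ (allFin n)) λ {i} _ → from (T-all⇔ (allFin n)) λ {j} _ → f i j)

module _ {A : Set} where

  lookup∈toList : ∀ {n} (xs : Vec A n) i → lookup xs i ∈ toList xs
  lookup∈toList (x Vec.∷ xs) zero    = here refl
  lookup∈toList (x Vec.∷ xs) (suc i) = there (lookup∈toList xs i)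

  ∈toList⇒lookup : ∀ {n} (xs : Vec A n) {x} → x ∈ toList xs → ∃[ i ] lookup xs i ≡ x
  ∈toList⇒lookup (x Vec.∷ xs) (here refl) = zero , refl
  ∈toList⇒lookup (x Vec.∷ xs) (there x∈)  = let i , eq = ∈toList⇒lookup xs x∈ in suc i , eq

  AllPairs⇔lookup : ∀ {R : A → A → Set} {n} (xs : Vec A n) →
    AllPairs R (toList xs) ⇔ (∀ i j → toℕ i < toℕ j → R (lookup xs i) (lookup xs j))
  AllPairs⇔lookup {R} xs = mk⇔ (AllPairs⇒lookup xs) (lookup⇒AllPairs xs)
    where
    AllPairs⇒lookup : ∀ {n} (xs : Vec A n) → AllPairs R (toList xs) →
      ∀ i j → toℕ i < toℕ j → R (lookup xs i) (lookup xs j)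
    AllPairs⇒lookup (x Vec.∷ xs) (r ∷ rs) zero    (suc j) _         = All.lookup r (lookup∈toList xs j)
    AllPairs⇒lookup (x Vec.∷ xs) (r ∷ rs) (suc i) (suc j) (s≤s i<j) = AllPairs⇒lookup xs rs i j i<j

    lookup⇒AllPairs : ∀ {n} (xs : Vec A n) →
      (∀ i j → toℕ i < toℕ j → R (lookup xs i) (lookup xs j)) → AllPairs R (toList xs)
    lookup⇒AllPairs Vec.[]       f = []
    lookup⇒AllPairs (x Vec.∷ xs) f =
      All.tabulate (λ y∈ → let j , eq = ∈toList⇒lookup xs y∈ in subst (R x) eq (f zero (suc j) (s≤s z≤n)))
      ∷ lookup⇒AllPairs xs (λ i j i<j → f (suc i) (suc j) (s≤s i<j))

WellFormed : ℕ → Block → Set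
WellFormed n (a , b) = 1 ≤ a × a < b × b ≤ 2 * n

-- The list order is the order of u-values, so monotonicity of u says that no
-- block is nested inside a later one.
record IsNCmton (n : ℕ) (bs : List Block) : Set where
  field
    wellFormed  : ∀ {B} → B ∈ bs → WellFormed n B
    covers      : ∀ {x} → 1 ≤ x → x ≤ 2 * n → countᵇ (containsᵇ x) bs ≡ 1
    nonCrossing : ∀ {B W} → B ∈ bs → W ∈ bs → ¬ T (crossingᵇ B W)
    monotone    : AllPairs (λ V W → ¬ T (nestedᵇ V W)) bs

wellFormedBlock⇔ : ∀ n B → T (wellFormedBlock n B) ⇔ WellFormed n B
wellFormedBlock⇔ n (a , b) = mk⇔
  (λ t → let t₁ , t₂ = to T-∧ t ; t₃ , t₄ = to T-∧ t₂ in
         ≤ᵇ⇒≤ 1 a t₁ , <ᵇ⇒< a b t₃ , ≤ᵇ⇒≤ b (2 * n) t₄)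
  (λ (p , q , r) → from T-∧ (≤⇒≤ᵇ p , from T-∧ (<⇒<ᵇ q , ≤⇒≤ᵇ r)))

∈-points⇔ : ∀ n {x} → x ∈ points n ⇔ (1 ≤ x × x ≤ 2 * n)
∈-points⇔ n = mk⇔ to′ from′
  where
  to′ : ∀ {x} → x ∈ points n → 1 ≤ x × x ≤ 2 * n
  to′ x∈ with ∈-map⁻ suc x∈
  ... | y , y∈ , refl = s≤s z≤n , ∈-upTo⁻ y∈
  from′ : ∀ {x} → 1 ≤ x × x ≤ 2 * n → x ∈ points n
  from′ {suc y} (_ , x≤) = ∈-map⁺ suc (∈-upTo⁺ x≤)

nestedᵇ-irrefl : ∀ V → ¬ T (nestedᵇ V V)
nestedᵇ-irrefl (a , b) t = <-irrefl refl (<ᵇ⇒< a a (proj₁ (to T-∧ t)))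

module _ {n} (bs : Vec Block n) where

  private
    N : Fin n → Fin n → Bool
    N i j = nestedᵇ (lookup bs i) (lookup bs j)

    NonCrossingᵇ : Bool
    NonCrossingᵇ = all (λ i → all (λ j → not (crossingᵇ (lookup bs i) (lookup bs j))) (allFin n)) (allFin n)

    Coversᵇ : Bool
    Coversᵇ = all (λ x → countᵇ (containsᵇ x) (toList bs) ≡ᵇ 1) (points n)

    Monotoneᵇ : Bool
    Monotoneᵇ = all (λ i → all (λ j → not (N i j) ∨ (toℕ j <ᵇ toℕ i)) (allFin n)) (allFin n)

  monotoneᵇ⇔ : T Monotoneᵇ ⇔ AllPairs (λ V W → ¬ T (nestedᵇ V W)) (toList bs)
  monotoneᵇ⇔ = mk⇔
    (λ t → from (AllPairs⇔lookup bs) λ i j i<j nest →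
       <-asym i<j (<ᵇ⇒< _ _ (to T-not-∨⇔ (to (T-all-allFin²⇔ _) t i j) nest)))
    (λ ps → from (T-all-allFin²⇔ λ i j → not (N i j) ∨ (toℕ j <ᵇ toℕ i)) λ i j →
       from T-not-∨⇔ λ nest → <⇒<ᵇ (later-not-nested (to (AllPairs⇔lookup bs) ps) i j nest))
    where
    later-not-nested : (∀ i j → toℕ i < toℕ j → ¬ T (N i j)) → ∀ i j → T (N i j) → toℕ j < toℕ i
    later-not-nested ps i j nest with <-cmp (toℕ i) (toℕ j)
    ... | tri< i<j _ _ = ⊥-elim (ps i j i<j nest)
    ... | tri≈ _ i≡j _ rewrite toℕ-injective i≡j = ⊥-elim (nestedᵇ-irrefl (lookup bs j) nest)
    ... | tri> _ _ j<i = j<i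

  nonCrossingᵇ⇔ : T NonCrossingᵇ ⇔ (∀ {B W} → B ∈ toList bs → W ∈ toList bs → ¬ T (crossingᵇ B W))
  nonCrossingᵇ⇔ = mk⇔ decode encode
    where
    decode : T NonCrossingᵇ → ∀ {B W} → B ∈ toList bs → W ∈ toList bs → ¬ T (crossingᵇ B W)
    decode t B∈ W∈ =
      let i , eqB = ∈toList⇒lookup bs B∈ ; j , eqW = ∈toList⇒lookup bs W∈ in
      subst₂ (λ B W → ¬ T (crossingᵇ B W)) eqB eqW (to T-not⇔ (to (T-all-allFin²⇔ _) t i j))
    encode : (∀ {B W} → B ∈ toList bs → W ∈ toList bs → ¬ T (crossingᵇ B W)) → T NonCrossingᵇ
    encode nc = from (T-all-allFin²⇔ _) λ i j → from T-not⇔ (nc (lookup∈toList bs i) (lookup∈toList bs j))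

  coversᵇ⇔ : T Coversᵇ ⇔ (∀ {x} → 1 ≤ x → x ≤ 2 * n → countᵇ (containsᵇ x) (toList bs) ≡ 1)
  coversᵇ⇔ = mk⇔ decode encode
    where
    decode : T Coversᵇ → ∀ {x} → 1 ≤ x → x ≤ 2 * n → countᵇ (containsᵇ x) (toList bs) ≡ 1
    decode t 1≤x x≤ = ≡ᵇ⇒≡ _ 1 (to (T-all⇔ (points n)) t (from (∈-points⇔ n) (1≤x , x≤)))
    encode : (∀ {x} → 1 ≤ x → x ≤ 2 * n → countᵇ (containsᵇ x) (toList bs) ≡ 1) → T Coversᵇ
    encode cov = from (T-all⇔ (points n)) λ x∈ →
      let 1≤x , x≤ = to (∈-points⇔ n) x∈ in ≡⇒≡ᵇ _ 1 (cov 1≤x x≤)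

  wellFormedᵇ⇔ : T (all (wellFormedBlock n) (toList bs)) ⇔ (∀ {B} → B ∈ toList bs → WellFormed n B)
  wellFormedᵇ⇔ = mk⇔ decode encode
    where
    decode : T (all (wellFormedBlock n) (toList bs)) → ∀ {B} → B ∈ toList bs → WellFormed n B
    decode t {B} B∈ = to (wellFormedBlock⇔ n B) (to (T-all⇔ (toList bs)) t B∈)
    encode : (∀ {B} → B ∈ toList bs → WellFormed n B) → T (all (wellFormedBlock n) (toList bs))
    encode wf = from (T-all⇔ (toList bs)) λ {B} B∈ → from (wellFormedBlock⇔ n B) (wf B∈)

  validᵇ⇔ : T (validᵇ n bs) ⇔ IsNCmton n (toList bs)
  validᵇ⇔ = mk⇔ decode encode
    where
    decode : T (validᵇ n bs) → IsNCmton n (toList bs)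
    decode t = let w , t₁ = to T-∧ t ; c , t₂ = to T-∧ t₁ ; x , m = to T-∧ t₂ in record
      { wellFormed  = to wellFormedᵇ⇔ w
      ; covers      = to coversᵇ⇔ c
      ; nonCrossing = to nonCrossingᵇ⇔ x
      ; monotone    = to monotoneᵇ⇔ m
      }
    encode : IsNCmton n (toList bs) → T (validᵇ n bs)
    encode v = from T-∧ (from wellFormedᵇ⇔ wellFormed , from T-∧ (from coversᵇ⇔ covers ,
                 from T-∧ (from nonCrossingᵇ⇔ nonCrossing , from monotoneᵇ⇔ monotone)))
      where open IsNCmton v

isNCmton : ∀ {n} (x : NCmton n) → IsNCmton n (toList (proj₁ x))
isNCmton (bs , v) = to (validᵇ⇔ bs) v

NCmton-≡ : ∀ {n} {x y : NCmton n} → proj₁ x ≡ proj₁ y → x ≡ y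
NCmton-≡ {x = bs , v} {.bs , w} refl = cong (bs ,_) (T-irrelevant v w)

nestedᵇ⇔ : ∀ {a b c d} → T (nestedᵇ (a , b) (c , d)) ⇔ (c < a × b < d)
nestedᵇ⇔ {a} {b} {c} {d} = mk⇔
  (λ t → let t₁ , t₂ = to T-∧ t in <ᵇ⇒< c a t₁ , <ᵇ⇒< b d t₂)
  (λ (c<a , b<d) → from T-∧ (<⇒<ᵇ c<a , <⇒<ᵇ b<d))

crossingᵇ⇔ : ∀ a b c d →
  T (crossingᵇ (a , b) (c , d)) ⇔ ((a < c × c < b × b < d) ⊎ (c < a × a < d × d < b))
crossingᵇ⇔ a b c d = mk⇔
  (λ t → Sum.map (decode a c b d) (decode c a d b) (to T-∨ t))
  (λ s → from T-∨ (Sum.map (encode a c b d) (encode c a d b) s))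
  where
  decode : ∀ x y z w → T ((x <ᵇ y) ∧ (y <ᵇ z) ∧ (z <ᵇ w)) → x < y × y < z × z < w
  decode x y z w t = let t₁ , t₂ = to T-∧ t ; t₃ , t₄ = to T-∧ t₂ in
    <ᵇ⇒< x y t₁ , <ᵇ⇒< y z t₃ , <ᵇ⇒< z w t₄
  encode : ∀ x y z w → x < y × y < z × z < w → T ((x <ᵇ y) ∧ (y <ᵇ z) ∧ (z <ᵇ w))
  encode x y z w (p , q , r) = from T-∧ (<⇒<ᵇ p , from T-∧ (<⇒<ᵇ q , <⇒<ᵇ r))

crossingᵇ-intro : ∀ {a b c d} → a < c → c < b → b < d → T (crossingᵇ (a , b) (c , d))
crossingᵇ-intro {a} {b} {c} {d} a<c c<b b<d = from (crossingᵇ⇔ a b c d) (inj₁ (a<c , c<b , b<d))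

containsᵇ-left : ∀ a b → T (containsᵇ a (a , b))
containsᵇ-left a b = from (containsᵇ⇔ a a b) (inj₁ refl)

containsᵇ-right : ∀ a b → T (containsᵇ b (a , b))
containsᵇ-right a b = from (containsᵇ⇔ b a b) (inj₂ refl)

module _ {n} {bs : List Block} (v : IsNCmton n bs) where
  open IsNCmton v

  left<right : ∀ {B} → B ∈ bs → proj₁ B < proj₂ B
  left<right B∈ = proj₁ (proj₂ (wellFormed B∈))

  containsᵇ⇒inRange : ∀ z {B} → B ∈ bs → T (containsᵇ z B) → 1 ≤ z × z ≤ 2 * n
  containsᵇ⇒inRange z {a , b} B∈ zB with wellFormed B∈ | to (containsᵇ⇔ z a b) zB
  ... | 1≤a , a<b , b≤ | inj₁ refl = 1≤a , ≤-trans (<⇒≤ a<b) b≤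
  ... | 1≤a , a<b , b≤ | inj₂ refl = ≤-trans 1≤a (<⇒≤ a<b) , b≤

  sharedPoint⇒≡ : ∀ z {B W} → B ∈ bs → W ∈ bs → T (containsᵇ z B) → T (containsᵇ z W) → B ≡ W
  sharedPoint⇒≡ z B∈ W∈ zB zW =
    let 1≤z , z≤ = containsᵇ⇒inRange z B∈ zB in
    countᵇ≤1⇒≡ (containsᵇ z) bs (≤-reflexive (covers 1≤z z≤)) B∈ W∈ zB zW

  inside⇒nested : ∀ {z c d a b} → (c , d) ∈ bs → (a , b) ∈ bs → T (containsᵇ z (c , d)) →
                  a < z → z < b → T (nestedᵇ (c , d) (a , b))
  inside⇒nested {z} {c} {d} {a} {b} C∈ J∈ zC a<z z<b with to (containsᵇ⇔ z c d) zC
  ... | inj₁ refl with <-cmp d b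
  ...   | tri< d<b _ _ = from nestedᵇ⇔ (a<z , d<b)
  ...   | tri≈ _ refl _ =
    ⊥-elim (<-irrefl (sym (cong proj₁ (sharedPoint⇒≡ d C∈ J∈ (containsᵇ-right c d) (containsᵇ-right a d)))) a<z)
  ...   | tri> _ _ b<d = ⊥-elim (nonCrossing J∈ C∈ (crossingᵇ-intro a<z z<b b<d))
  inside⇒nested {z} {c} {d} {a} {b} C∈ J∈ zC a<z z<b | inj₂ refl with <-cmp a c
  ...   | tri< a<c _ _ = from nestedᵇ⇔ (a<c , z<b)
  ...   | tri≈ _ refl _ =
    ⊥-elim (<-irrefl (cong proj₂ (sharedPoint⇒≡ a C∈ J∈ (containsᵇ-left a d) (containsᵇ-left a b))) z<b)
  ...   | tri> _ _ c<a = ⊥-elim (nonCrossing C∈ J∈ (crossingᵇ-intro c<a a<z z<b))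

  rightEnds-distinct : AllPairs (λ B C → proj₂ B ≢ proj₂ C) bs
  rightEnds-distinct = distinct bs λ {(a , b)} B∈ →
    let 1≤b , b≤ = containsᵇ⇒inRange b B∈ (containsᵇ-right a b) in ≤-reflexive (covers 1≤b b≤)
    where
    distinct : ∀ xs → (∀ {B} → B ∈ xs → countᵇ (containsᵇ (proj₂ B)) xs ≤ 1) →
               AllPairs (λ B C → proj₂ B ≢ proj₂ C) xs
    distinct []            _   = []
    distinct ((a , b) ∷ xs) c≤1 =
      All.tabulate (λ {(c , d)} C∈ b≡d → countᵇ≤1-head (containsᵇ b) xs (containsᵇ-right a b) (c≤1 (here refl)) C∈
                                           (subst (λ z → T (containsᵇ z (c , d))) (sym b≡d) (containsᵇ-right c d)))
      ∷ distinct xs (λ C∈ → ≤-trans (m≤n+m _ _) (c≤1 (there C∈)))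

pairAt : ℕ → Block
pairAt m = m , suc m

-- φ of the paper, for J = pairAt m, extended to all of ℕ; its left inverse is relabel (pairAt m).
φ : ℕ → ℕ → ℕ
φ m y = if y <ᵇ m then y else suc (suc y)

φᴮ : ℕ → Block → Block
φᴮ m (p , q) = φ m p , φ m q

φ-< : ∀ {m y} → y < m → φ m y ≡ y
φ-< y<m rewrite <ᵇ≡true y<m = refl

φ-≥ : ∀ {m y} → m ≤ y → φ m y ≡ suc (suc y)
φ-≥ m≤y rewrite <ᵇ≡false m≤y = refl

φ-<ᵇ : ∀ m a c → (φ m a <ᵇ φ m c) ≡ (a <ᵇ c)
φ-<ᵇ m a c with a <? m | c <? m
... | yes a<m | yes c<m rewrite φ-< a<m | φ-< c<m = refl
... | no a≮m  | no c≮m  rewrite φ-≥ (≮⇒≥ a≮m) | φ-≥ (≮⇒≥ c≮m) = refl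
... | yes a<m | no c≮m  rewrite φ-< a<m | φ-≥ (≮⇒≥ c≮m) =
  trans (<ᵇ≡true (<-trans a<c (<-trans (n<1+n c) (n<1+n _)))) (sym (<ᵇ≡true a<c))
  where a<c = <-≤-trans a<m (≮⇒≥ c≮m)
... | no a≮m  | yes c<m rewrite φ-≥ (≮⇒≥ a≮m) | φ-< c<m =
  trans (<ᵇ≡false (≤-trans (<⇒≤ c<a) (≤-trans (n≤1+n a) (n≤1+n _)))) (sym (<ᵇ≡false (<⇒≤ c<a)))
  where c<a = <-≤-trans c<m (≮⇒≥ a≮m)

φ-mono-< : ∀ m {a c} → a < c → φ m a < φ m c
φ-mono-< m {a} {c} a<c = <ᵇ⇒< _ _ (subst T (sym (φ-<ᵇ m a c)) (<⇒<ᵇ a<c))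

φ-avoids : ∀ m y → φ m y < m ⊎ suc m < φ m y
φ-avoids m y with y <? m
... | yes y<m = inj₁ (subst (_< m) (sym (φ-< y<m)) y<m)
... | no y≮m  = inj₂ (subst (suc m <_) (sym (φ-≥ (≮⇒≥ y≮m))) (s≤s (s≤s (≮⇒≥ y≮m))))

φ≢m : ∀ m y → φ m y ≢ m
φ≢m m y eq with φ-avoids m y
... | inj₁ φy<m = <-irrefl eq φy<m
... | inj₂ m<φy = <-asym (subst (suc m <_) eq m<φy) (n<1+n m)

φ≢suc : ∀ m y → φ m y ≢ suc m
φ≢suc m y eq with φ-avoids m y
... | inj₁ φy<m = <-asym (subst (_< m) eq φy<m) (n<1+n m)
... | inj₂ m<φy = <-irrefl (sym eq) m<φy

relabel-φ : ∀ m y → relabel (pairAt m) (φ m y) ≡ y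
relabel-φ m y with y <? m
... | yes y<m rewrite φ-< y<m | <ᵇ≡false {m} (<⇒≤ y<m) | <ᵇ≡false {suc m} (m≤n⇒m≤1+n (<⇒≤ y<m)) = refl
... | no y≮m  rewrite φ-≥ (≮⇒≥ y≮m) | <ᵇ≡true {m} {suc (suc y)} (s≤s (m≤n⇒m≤1+n (≮⇒≥ y≮m)))
                                    | <ᵇ≡true {suc m} {suc (suc y)} (s≤s (s≤s (≮⇒≥ y≮m))) = refl

φ-relabel : ∀ {m x} → x ≢ m → x ≢ suc m → φ m (relabel (pairAt m) x) ≡ x
φ-relabel {m} {x} x≢m x≢sm with <-cmp x m
... | tri< x<m _ _ rewrite <ᵇ≡false {m} (<⇒≤ x<m) | <ᵇ≡false {suc m} (m≤n⇒m≤1+n (<⇒≤ x<m)) = φ-< x<m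
... | tri≈ _ x≡m _ = ⊥-elim (x≢m x≡m)
... | tri> _ _ m<x = above x (≤∧≢⇒< m<x (x≢sm ∘ sym))
  where
  above : ∀ x → suc m < x → φ m (relabel (pairAt m) x) ≡ x
  above (suc (suc y)) (s≤s (s≤s m≤y))
    rewrite <ᵇ≡true {m} {suc (suc y)} (s≤s (m≤n⇒m≤1+n m≤y))
          | <ᵇ≡true {suc m} {suc (suc y)} (s≤s (s≤s m≤y)) = φ-≥ m≤y

φ-injective : ∀ m {a c} → φ m a ≡ φ m c → a ≡ c
φ-injective m {a} {c} eq = trans (sym (relabel-φ m a)) (trans (cong (relabel (pairAt m)) eq) (relabel-φ m c))

φ-≡ᵇ : ∀ m a c → (φ m a ≡ᵇ φ m c) ≡ (a ≡ᵇ c)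
φ-≡ᵇ m a c with a ≟ c
... | yes refl = trans (≡ᵇ-refl (φ m a)) (sym (≡ᵇ-refl a))
... | no a≢c   = trans (≡ᵇ≡false (a≢c ∘ φ-injective m)) (sym (≡ᵇ≡false a≢c))

nestedᵇ-φᴮ : ∀ m B W → nestedᵇ (φᴮ m B) (φᴮ m W) ≡ nestedᵇ B W
nestedᵇ-φᴮ m (a , b) (c , d) = cong₂ _∧_ (φ-<ᵇ m c a) (φ-<ᵇ m b d)

crossingᵇ-φᴮ : ∀ m B W → crossingᵇ (φᴮ m B) (φᴮ m W) ≡ crossingᵇ B W
crossingᵇ-φᴮ m (a , b) (c , d)
  rewrite φ-<ᵇ m a c | φ-<ᵇ m c b | φ-<ᵇ m b d | φ-<ᵇ m c a | φ-<ᵇ m a d | φ-<ᵇ m d b = refl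

containsᵇ-φᴮ : ∀ m z B → containsᵇ (φ m z) (φᴮ m B) ≡ containsᵇ z B
containsᵇ-φᴮ m z (a , b) = cong₂ _∨_ (φ-≡ᵇ m z a) (φ-≡ᵇ m z b)

¬containsᵇ-φᴮ : ∀ m B → ¬ T (containsᵇ m (φᴮ m B)) × ¬ T (containsᵇ (suc m) (φᴮ m B))
¬containsᵇ-φᴮ m (a , b) =
  [ φ≢m m a ∘ sym , φ≢m m b ∘ sym ]′ ∘ to (containsᵇ⇔ m (φ m a) (φ m b)) ,
  [ φ≢suc m a ∘ sym , φ≢suc m b ∘ sym ]′ ∘ to (containsᵇ⇔ (suc m) (φ m a) (φ m b))

insertPair : ∀ {n} → ℕ → Vec Block n → Vec Block (suc n)
insertPair m bs = Vec.map (φᴮ m) bs ∷ʳ pairAt m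

insertPairᴸ : ℕ → List Block → List Block
insertPairᴸ m bs = List.map (φᴮ m) bs ++ [ pairAt m ]

toList-insertPair : ∀ {n} m (bs : Vec Block n) → toList (insertPair m bs) ≡ insertPairᴸ m (toList bs)
toList-insertPair m bs =
  trans (toList-∷ʳ (pairAt m) (Vec.map (φᴮ m) bs)) (cong (_++ [ pairAt m ]) (toList-map (φᴮ m) bs))

insertPair-injective : ∀ {n} (bs : Vec Block n) {m m′} → insertPair m bs ≡ insertPair m′ bs → m ≡ m′
insertPair-injective bs {m} {m′} eq =
  cong proj₁ (trans (sym (last-∷ʳ (pairAt m) (Vec.map (φᴮ m) bs)))
             (trans (cong last eq) (last-∷ʳ (pairAt m′) (Vec.map (φᴮ m′) bs))))

pairParent-insertPair : ∀ {k} m (ρ : Vec Block (suc k)) v → pairParent (insertPair m ρ , v) ≡ ρ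
pairParent-insertPair m ρ v
  rewrite last-∷ʳ (pairAt m) (Vec.map (φᴮ m) ρ) | init-∷ʳ (pairAt m) (Vec.map (φᴮ m) ρ) = begin
    Vec.map (relabelBlock (pairAt m)) (Vec.map (φᴮ m) ρ) ≡⟨ map-∘ _ _ ρ ⟨
    Vec.map (relabelBlock (pairAt m) ∘ φᴮ m) ρ
      ≡⟨ map-cong (λ (a , b) → cong₂ _,_ (relabel-φ m a) (relabel-φ m b)) ρ ⟩
    Vec.map id ρ                                         ≡⟨ map-id ρ ⟩
    ρ                                                    ∎
  where open ≡-Reasoning

nothing-between : ∀ {m x} → m < x → x < suc m → ⊥
nothing-between m<x x<sm = <⇒≱ m<x (≤-pred x<sm)

¬crossingᵇ-pairAtˡ : ∀ m W → ¬ T (crossingᵇ (pairAt m) W)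
¬crossingᵇ-pairAtˡ m (c , d) t with to (crossingᵇ⇔ m (suc m) c d) t
... | inj₁ (m<c , c<sm , _) = nothing-between m<c c<sm
... | inj₂ (_ , m<d , d<sm) = nothing-between m<d d<sm

¬crossingᵇ-pairAtʳ : ∀ m B → ¬ T (crossingᵇ B (pairAt m))
¬crossingᵇ-pairAtʳ m (a , b) t with to (crossingᵇ⇔ a b m (suc m)) t
... | inj₁ (_ , m<b , b<sm) = nothing-between m<b b<sm
... | inj₂ (m<a , a<sm , _) = nothing-between m<a a<sm

¬nestedᵇ-pairAt : ∀ m {a b} → a < b → ¬ T (nestedᵇ (a , b) (pairAt m))
¬nestedᵇ-pairAt m a<b t = let m<a , b<sm = to nestedᵇ⇔ t in <⇒≱ (<-trans m<a a<b) (≤-pred b<sm)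

φ-inflationary : ∀ m y → y ≤ φ m y
φ-inflationary m y with y <? m
... | yes y<m = ≤-reflexive (sym (φ-< y<m))
... | no y≮m  = ≤-trans (n≤1+n y) (≤-trans (n≤1+n _) (≤-reflexive (sym (φ-≥ (≮⇒≥ y≮m)))))

φ-≤ : ∀ m y → φ m y ≤ suc (suc y)
φ-≤ m y with y <? m
... | yes y<m = ≤-trans (≤-reflexive (φ-< y<m)) (≤-trans (n≤1+n y) (n≤1+n _))
... | no y≮m  = ≤-reflexive (φ-≥ (≮⇒≥ y≮m))

module _ {n} {bs : List Block} (v : IsNCmton n bs) {m} (1≤m : 1 ≤ m) (m≤ : m ≤ suc (2 * n)) where
  open IsNCmton v

  private
    bs′ : List Block
    bs′ = insertPairᴸ m bs

    φ-inRange : ∀ {y} → 1 ≤ y → y ≤ 2 * n → 1 ≤ φ m y × φ m y ≤ 2 * suc n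
    φ-inRange {y} 1≤y y≤ =
      ≤-trans 1≤y (φ-inflationary m y) ,
      ≤-trans (φ-≤ m y) (subst (suc (suc y) ≤_) (sym (*-suc 2 n)) (s≤s (s≤s y≤)))

    φ-reflects-inRange : ∀ {y} → 1 ≤ φ m y → φ m y ≤ 2 * suc n → 1 ≤ y × y ≤ 2 * n
    φ-reflects-inRange {y} 1≤φy φy≤ with y <? m
    ... | yes y<m rewrite φ-< y<m = 1≤φy , ≤-pred (≤-trans y<m m≤)
    ... | no y≮m  rewrite φ-≥ (≮⇒≥ y≮m) =
      ≤-trans 1≤m (≮⇒≥ y≮m) , ≤-pred (≤-pred (subst (suc (suc y) ≤_) (*-suc 2 n) φy≤))

    wellFormed′ : ∀ {B} → B ∈ bs′ → WellFormed (suc n) B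
    wellFormed′ B∈ with ∈-++⁻ (List.map (φᴮ m) bs) B∈
    ... | inj₂ (here refl) = 1≤m , n<1+n m , subst (suc m ≤_) (sym (*-suc 2 n)) (s≤s m≤)
    ... | inj₁ B∈map with ∈-map⁻ (φᴮ m) B∈map
    ...   | (a , b) , B∈bs , refl =
      let 1≤a , a<b , b≤ = wellFormed B∈bs in
      proj₁ (φ-inRange 1≤a (≤-trans (<⇒≤ a<b) b≤)) ,
      φ-mono-< m a<b ,
      proj₂ (φ-inRange (≤-trans 1≤a (<⇒≤ a<b)) b≤)

    covers′ : ∀ {x} → 1 ≤ x → x ≤ 2 * suc n → countᵇ (containsᵇ x) bs′ ≡ 1
    covers′ {x} 1≤x x≤ = begin
      countᵇ (containsᵇ x) bs′
        ≡⟨ countᵇ-++ _ (List.map (φᴮ m) bs) _ ⟩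
      countᵇ (containsᵇ x) (List.map (φᴮ m) bs) + countᵇ (containsᵇ x) [ pairAt m ]
        ≡⟨ cong (_+ _) (countᵇ-map _ (φᴮ m) bs) ⟩
      countᵇ (containsᵇ x ∘ φᴮ m) bs + countᵇ (containsᵇ x) [ pairAt m ]
        ≡⟨ by-position ⟩
      1 ∎
      where
      open ≡-Reasoning
      by-position : countᵇ (containsᵇ x ∘ φᴮ m) bs + countᵇ (containsᵇ x) [ pairAt m ] ≡ 1
      by-position with x ≟ m | x ≟ suc m
      ... | yes refl | _
        rewrite countᵇ-none (containsᵇ x ∘ φᴮ m) bs (λ {B} _ → proj₁ (¬containsᵇ-φᴮ m B))
              | to T-≡ (containsᵇ-left m (suc m)) = refl
      ... | no _ | yes refl
        rewrite countᵇ-none (containsᵇ x ∘ φᴮ m) bs (λ {B} _ → proj₂ (¬containsᵇ-φᴮ m B))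
              | to T-≡ (containsᵇ-right m (suc m)) = refl
      ... | no x≢m | no x≢sm
        rewrite ≡ᵇ≡false x≢m | ≡ᵇ≡false x≢sm = begin
          countᵇ (containsᵇ x ∘ φᴮ m) bs + 0 ≡⟨ +-identityʳ _ ⟩
          countᵇ (containsᵇ x ∘ φᴮ m) bs    ≡⟨ countᵇ-cong bs (λ {B} _ → subst (λ z → containsᵇ z (φᴮ m B) ≡ containsᵇ y B)
                                                                             (φ-relabel x≢m x≢sm) (containsᵇ-φᴮ m y B)) ⟩
          countᵇ (containsᵇ y) bs           ≡⟨ covers (proj₁ y-inRange) (proj₂ y-inRange) ⟩
          1 ∎
        where
        y = relabel (pairAt m) x
        y-inRange : 1 ≤ y × y ≤ 2 * n
        y-inRange = φ-reflects-inRange (subst (1 ≤_) (sym (φ-relabel x≢m x≢sm)) 1≤x)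
                                       (subst (_≤ 2 * suc n) (sym (φ-relabel x≢m x≢sm)) x≤)

    nonCrossing′ : ∀ {B W} → B ∈ bs′ → W ∈ bs′ → ¬ T (crossingᵇ B W)
    nonCrossing′ {B} {W} B∈ W∈ with ∈-++⁻ (List.map (φᴮ m) bs) B∈ | ∈-++⁻ (List.map (φᴮ m) bs) W∈
    ... | inj₂ (here refl) | _                = ¬crossingᵇ-pairAtˡ m W
    ... | inj₁ _           | inj₂ (here refl) = ¬crossingᵇ-pairAtʳ m B
    ... | inj₁ B∈map       | inj₁ W∈map with ∈-map⁻ (φᴮ m) B∈map | ∈-map⁻ (φᴮ m) W∈map
    ...   | B , B∈bs , refl | W , W∈bs , refl =
      subst (¬_ ∘ T) (sym (crossingᵇ-φᴮ m B W)) (nonCrossing B∈bs W∈bs)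

    monotone′ : AllPairs (λ V W → ¬ T (nestedᵇ V W)) bs′
    monotone′ = AllPairsₚ.++⁺
      (AllPairsₚ.map⁺ (AllPairs.map (λ {B} {W} ¬n → ¬n ∘ subst T (nestedᵇ-φᴮ m B W)) monotone))
      ([] ∷ [])
      (Allₚ.map⁺ (All.tabulate λ B∈ → ¬nestedᵇ-pairAt m (φ-mono-< m (left<right v B∈)) ∷ []))

  insertPair-isNCmton : IsNCmton (suc n) bs′
  insertPair-isNCmton = record
    { wellFormed = wellFormed′ ; covers = covers′ ; nonCrossing = nonCrossing′ ; monotone = monotone′ }

AllPairs-++-across : ∀ {A : Set} {R : A → A → Set} {xs ys : List A} {x y} →
  AllPairs R (xs ++ ys) → x ∈ xs → y ∈ ys → R x y
AllPairs-++-across {xs = _ ∷ xs} (r ∷ _)  (here refl) y∈ = All.lookup r (∈-++⁺ʳ xs y∈)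
AllPairs-++-across {xs = _ ∷ _}  (_ ∷ rs) (there x∈)  y∈ = AllPairs-++-across rs x∈ y∈

module _ {n} {bs : List Block} {a b} (v : IsNCmton n (bs ++ [ (a , b) ])) where
  open IsNCmton v

  private
    J∈ : (a , b) ∈ bs ++ [ (a , b) ]
    J∈ = ∈-++⁺ʳ bs (here refl)

  disjoint-from-last : ∀ z {C} → T (containsᵇ z (a , b)) → C ∈ bs → ¬ T (containsᵇ z C)
  disjoint-from-last z zJ C∈ zC = <⇒≱ two≤count (≤-reflexive (covers 1≤z z≤))
    where
    1≤z = proj₁ (containsᵇ⇒inRange v z J∈ zJ)
    z≤  = proj₂ (containsᵇ⇒inRange v z J∈ zJ)
    two≤count : 2 ≤ countᵇ (containsᵇ z) (bs ++ [ (a , b) ])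
    two≤count = subst (2 ≤_) (sym (countᵇ-++ _ bs [ (a , b) ]))
      (+-mono-≤ (∈⇒countᵇ-pos (containsᵇ z) bs C∈ zC)
                (∈⇒countᵇ-pos (containsᵇ z) [ (a , b) ] (here refl) zJ))

  private
    no-point-inside : suc a < b → ⊥
    no-point-inside sa<b
      with countᵇ-pos⇒∈ (containsᵇ (suc a)) (bs ++ [ (a , b) ])
             (≤-reflexive (sym (covers (s≤s z≤n) (≤-trans (<⇒≤ sa<b) (proj₂ (proj₂ (wellFormed J∈)))))))
    ... | C , C∈ , zC with ∈-++⁻ bs C∈
    ...   | inj₁ C∈bs        = AllPairs-++-across monotone C∈bs (here refl) (inside⇒nested v C∈ J∈ zC (n<1+n a) sa<b)
    ...   | inj₂ (here refl) with to (containsᵇ⇔ (suc a) a b) zC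
    ...     | inj₁ sa≡a = <-irrefl (sym sa≡a) (n<1+n a)
    ...     | inj₂ sa≡b = <-irrefl sa≡b sa<b

  -- Otherwise the block of the point a + 1 would be nested in the last block (a , b).
  lastBlock-isInterval : b ≡ suc a
  lastBlock-isInterval with b ≟ suc a
  ... | yes b≡sa = b≡sa
  ... | no  b≢sa = ⊥-elim (no-point-inside (≤∧≢⇒< (left<right v J∈) (b≢sa ∘ sym)))

φᴮ-relabelBlock : ∀ m C → ¬ T (containsᵇ m C) → ¬ T (containsᵇ (suc m) C) →
                  φᴮ m (relabelBlock (pairAt m) C) ≡ C
φᴮ-relabelBlock m (c , d) ¬m ¬sm = cong₂ _,_
  (φ-relabel (¬m ∘ from (containsᵇ⇔ m c d) ∘ inj₁ ∘ sym) (¬sm ∘ from (containsᵇ⇔ (suc m) c d) ∘ inj₁ ∘ sym))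
  (φ-relabel (¬m ∘ from (containsᵇ⇔ m c d) ∘ inj₂ ∘ sym) (¬sm ∘ from (containsᵇ⇔ (suc m) c d) ∘ inj₂ ∘ sym))

insertPair-relabel : ∀ {n} m (ys : Vec Block n) →
  (∀ {C} → C ∈ toList ys → ¬ T (containsᵇ m C) × ¬ T (containsᵇ (suc m) C)) →
  insertPair m (Vec.map (relabelBlock (pairAt m)) ys) ≡ ys ∷ʳ pairAt m
insertPair-relabel m ys avoids = cong (_∷ʳ pairAt m) (φᴮ∘relabel ys avoids)
  where
  φᴮ∘relabel : ∀ {n} (ys : Vec Block n) →
    (∀ {C} → C ∈ toList ys → ¬ T (containsᵇ m C) × ¬ T (containsᵇ (suc m) C)) →
    Vec.map (φᴮ m) (Vec.map (relabelBlock (pairAt m)) ys) ≡ ys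
  φᴮ∘relabel Vec.[]       _      = refl
  φᴮ∘relabel (C Vec.∷ ys) avoids = cong₂ Vec._∷_
    (φᴮ-relabelBlock m C (proj₁ (avoids (here refl))) (proj₂ (avoids (here refl))))
    (φᴮ∘relabel ys (avoids ∘ there))

lastBlock-insertPair : ∀ {n} (ys : Vec Block n) a b → IsNCmton (suc n) (toList ys ++ [ (a , b) ]) →
  ∃[ m ] (1 ≤ m × m ≤ suc (2 * n) × insertPair m (Vec.map (relabelBlock (a , b)) ys) ≡ ys ∷ʳ (a , b))
lastBlock-insertPair {n} ys a b v with lastBlock-isInterval v
... | refl = a , 1≤a , ≤-pred (subst (suc a ≤_) (*-suc 2 n) sa≤) , insertPair-relabel a ys avoids
  where
  1≤a = proj₁ (IsNCmton.wellFormed v (∈-++⁺ʳ (toList ys) (here refl)))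
  sa≤ = proj₂ (proj₂ (IsNCmton.wellFormed v (∈-++⁺ʳ (toList ys) (here refl))))
  avoids : ∀ {C} → C ∈ toList ys → ¬ T (containsᵇ a C) × ¬ T (containsᵇ (suc a) C)
  avoids C∈ = disjoint-from-last v a (containsᵇ-left a (suc a)) C∈ ,
              disjoint-from-last v (suc a) (containsᵇ-right a (suc a)) C∈

pairParent⇒insertPair : ∀ {k} (x : NCmton (suc (suc k))) →
  ∃[ m ] (1 ≤ m × m ≤ suc (2 * suc k) × insertPair m (pairParent x) ≡ proj₁ x)
pairParent⇒insertPair (bs , valid) with initLast bs
... | ys , (a , b) , refl =
  lastBlock-insertPair ys a b (subst (IsNCmton _) (toList-∷ʳ (a , b) ys) (isNCmton (ys ∷ʳ (a , b) , valid)))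

InRange : ℕ → ℕ → Set
InRange n m = 1 ≤ m × m ≤ suc (2 * n)

module Insertions {k} (ρ : NCmton (suc k)) where

  child : ∀ {m} → InRange (suc k) m → NCmton (suc (suc k))
  child {m} (1≤m , m≤) = insertPair m (proj₁ ρ) , from (validᵇ⇔ _)
    (subst (IsNCmton _) (sym (toList-insertPair m (proj₁ ρ))) (insertPair-isNCmton (isNCmton ρ) 1≤m m≤))

  child-injective : ∀ {m m′} (r : InRange (suc k) m) (r′ : InRange (suc k) m′) →
                    child r ≡ child r′ → m ≡ m′
  child-injective r r′ eq = insertPair-injective (proj₁ ρ) (cong proj₁ eq)

  pairParent-child : ∀ {m} (r : InRange (suc k) m) → pairParent (child r) ≡ proj₁ ρ
  pairParent-child {m} r = pairParent-insertPair m (proj₁ ρ) (proj₂ (child r))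

  pairParent⇒child : ∀ x → pairParent x ≡ proj₁ ρ → ∃[ m ] Σ[ r ∈ InRange (suc k) m ] child r ≡ x
  pairParent⇒child x refl with pairParent⇒insertPair x
  ... | m , 1≤m , m≤ , eq = m , (1≤m , m≤) , NCmton-≡ eq

  children : (ms : List ℕ) → All (InRange (suc k)) ms → List (NCmton (suc (suc k)))
  children []       []       = []
  children (m ∷ ms) (r ∷ rs) = child r ∷ children ms rs

  length-children : ∀ ms rs → length (children ms rs) ≡ length ms
  length-children []       []       = refl
  length-children (m ∷ ms) (r ∷ rs) = cong suc (length-children ms rs)

  All-children : ∀ {P : NCmton (suc (suc k)) → Set} ms rs →
    (∀ {m} (r : InRange (suc k) m) → m ∈ ms → P (child r)) → All P (children ms rs)
  All-children []       []       _ = []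
  All-children (m ∷ ms) (r ∷ rs) p = p r (here refl) ∷ All-children ms rs (λ r′ → p r′ ∘ there)

  ∈-children : ∀ {m} ms rs → m ∈ ms → (r : InRange (suc k) m) → child r ∈ children ms rs
  ∈-children (m ∷ ms) (r′ ∷ rs) (here refl) r = here (NCmton-≡ refl)
  ∈-children (m ∷ ms) (r′ ∷ rs) (there m∈)  r = there (∈-children ms rs m∈ r)

  children-unique : ∀ ms rs → Unique ms → Unique (children ms rs)
  children-unique []       []       []           = []
  children-unique (m ∷ ms) (r ∷ rs) (m∉ms ∷ ms!) =
    All-children ms rs (λ r′ m′∈ eq → All.lookup m∉ms m′∈ (child-injective r r′ eq))
    ∷ children-unique ms rs ms!

-- C_o(ρ, v) given by the gaps at which its elements insert their new pair.
record InsertionCriterion (Z : (n : ℕ) → NCmton n → ℕ) (α β q : ℕ) {k} (ρ : NCmton (suc k)) : Set where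
  field
    positions         : List ℕ
    positions-unique  : Unique positions
    positions-inRange : All (InRange (suc k)) positions
    Z-at  : ∀ {m} (r : InRange (suc k) m) → m ∈ positions →
            Z (suc (suc k)) (Insertions.child ρ r) ≡ Z (suc k) ρ + α
    Z-off : ∀ {m} (r : InRange (suc k) m) → m ∉ positions →
            Z (suc (suc k)) (Insertions.child ρ r) ≡ Z (suc k) ρ + β
    length-positions : length positions ≡ Z (suc k) ρ + q

pairRecursive2-intro : ∀ {Z α β q} → (∀ {k} (ρ : NCmton (suc k)) → InsertionCriterion Z α β q ρ) →
                       PairRecursive2 Z α β q
pairRecursive2-intro {Z} {α} {β} {q} criterion k ρ =
  Co ,
  children-unique positions positions-inRange positions-unique ,
  All-children positions positions-inRange (λ r _ → pairParent-child r) ,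
  All-children positions positions-inRange Z-at ,
  off ,
  trans (length-children positions positions-inRange) length-positions
  where
  open Insertions ρ
  open InsertionCriterion (criterion ρ)
  Co = children positions positions-inRange
  off : ∀ x → pairParent x ≡ proj₁ ρ → x ∉ Co → Z (suc (suc k)) x ≡ Z (suc k) ρ + β
  off x x↦ρ x∉ with pairParent⇒child x x↦ρ
  ... | m , r , refl = Z-off r (λ m∈ → x∉ (∈-children positions positions-inRange m∈ r))

isInterval : Block → Bool
isInterval (a , b) = b ≡ᵇ suc a

isInterval-φᴮ : ∀ m {a b} → a < b → isInterval (φᴮ m (a , b)) ≡ isInterval (a , b) ∧ not (b ≡ᵇ m)
isInterval-φᴮ m {a} {b} a<b with <-cmp b m
... | tri< b<m _ _ rewrite φ-< (<-trans a<b b<m) | φ-< b<m | ≡ᵇ≡false (<⇒≢ b<m) = sym (∧-identityʳ _)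
... | tri≈ _ refl _ rewrite φ-< a<b | φ-≥ (≤-refl {b}) | ≡ᵇ-refl b
                          | ≡ᵇ≡false {suc (suc b)} {suc a} (<⇒≢ (s≤s (m≤n⇒m≤1+n a<b)) ∘ sym) = sym (∧-zeroʳ _)
... | tri> _ _ m<b with a <? m
...   | yes a<m rewrite φ-< a<m | φ-≥ (<⇒≤ m<b)
                      | ≡ᵇ≡false {suc (suc b)} {suc a} (<⇒≢ (s≤s (m≤n⇒m≤1+n a<b)) ∘ sym)
                      | ≡ᵇ≡false {b} {suc a} (<⇒≢ (≤-<-trans a<m m<b) ∘ sym) = refl
...   | no a≮m  rewrite φ-≥ (≮⇒≥ a≮m) | φ-≥ (<⇒≤ m<b) | ≡ᵇ≡false (<⇒≢ m<b ∘ sym) = sym (∧-identityʳ _)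

intervalEnds : List Block → List ℕ
intervalEnds bs = List.map proj₂ (filter (T? ∘ isInterval) bs)

∈-intervalEnds⁻ : ∀ {m bs} → m ∈ intervalEnds bs → ∃[ B ] (B ∈ bs × T (isInterval B) × proj₂ B ≡ m)
∈-intervalEnds⁻ m∈ with ∈-map⁻ proj₂ m∈
... | B , B∈ , refl = let B∈bs , iB = ∈-filter⁻ (T? ∘ isInterval) B∈ in B , B∈bs , iB , refl

∈-intervalEnds⁺ : ∀ {B bs} → B ∈ bs → T (isInterval B) → proj₂ B ∈ intervalEnds bs
∈-intervalEnds⁺ B∈ iB = ∈-map⁺ proj₂ (∈-filter⁺ (T? ∘ isInterval) B∈ iB)

length-intervalEnds : ∀ bs → length (intervalEnds bs) ≡ countᵇ isInterval bs
length-intervalEnds bs =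
  trans (length-map proj₂ (filter (T? ∘ isInterval) bs)) (sym (countᵇ≡length-filter isInterval bs))

Int-insertPair : ∀ m bs → (∀ {B} → B ∈ bs → proj₁ B < proj₂ B) →
  countᵇ isInterval (insertPairᴸ m bs) + countᵇ (λ B → isInterval B ∧ (proj₂ B ≡ᵇ m)) bs
  ≡ countᵇ isInterval bs + 1
Int-insertPair m bs a<b = begin
  countᵇ isInterval (insertPairᴸ m bs) + E
    ≡⟨ cong (_+ E) (countᵇ-++ isInterval (List.map (φᴮ m) bs) _) ⟩
  countᵇ isInterval (List.map (φᴮ m) bs) + countᵇ isInterval [ pairAt m ] + E
    ≡⟨ cong (λ c → c + _ + E) (countᵇ-map isInterval (φᴮ m) bs) ⟩
  countᵇ (isInterval ∘ φᴮ m) bs + countᵇ isInterval [ pairAt m ] + E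
    ≡⟨ cong₂ (λ c i → c + i + E) (countᵇ-cong bs (λ B∈ → isInterval-φᴮ m (a<b B∈)))
                                 (cong (λ b → (if b then 1 else 0) + 0) (≡ᵇ-refl m)) ⟩
  countᵇ (λ B → isInterval B ∧ not (proj₂ B ≡ᵇ m)) bs + 1 + E
    ≡⟨ +-comm _ E ⟩
  E + (countᵇ (λ B → isInterval B ∧ not (proj₂ B ≡ᵇ m)) bs + 1)
    ≡⟨ +-assoc E _ 1 ⟨
  E + countᵇ (λ B → isInterval B ∧ not (proj₂ B ≡ᵇ m)) bs + 1
    ≡⟨ cong (_+ 1) (countᵇ-split isInterval (λ B → proj₂ B ≡ᵇ m) bs) ⟨
  countᵇ isInterval bs + 1 ∎
  where
  open ≡-Reasoning
  E = countᵇ (λ B → isInterval B ∧ (proj₂ B ≡ᵇ m)) bs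

module _ {n} {bs : List Block} (v : IsNCmton n bs) where
  open IsNCmton v

  intervalsEndingAt : ℕ → ℕ
  intervalsEndingAt m = countᵇ (λ B → isInterval B ∧ (proj₂ B ≡ᵇ m)) bs

  intervalsEndingAt-∈ : ∀ {m} → m ∈ intervalEnds bs → intervalsEndingAt m ≡ 1
  intervalsEndingAt-∈ {m} m∈ with ∈-intervalEnds⁻ m∈
  ... | (a , b) , B∈ , iB , refl = ≤-antisym
    (≤-trans (countᵇ-mono bs ends⇒contains) (≤-reflexive (covers (proj₁ b-inRange) (proj₂ b-inRange))))
    (∈⇒countᵇ-pos _ bs B∈ (from T-∧ (iB , ≡⇒≡ᵇ b b refl)))
    where
    b-inRange = containsᵇ⇒inRange v b B∈ (containsᵇ-right a b)
    ends⇒contains : ∀ {C} → C ∈ bs → T (isInterval C ∧ (proj₂ C ≡ᵇ b)) → T (containsᵇ b C)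
    ends⇒contains {c , d} _ t = from (containsᵇ⇔ b c d) (inj₂ (sym (≡ᵇ⇒≡ d b (proj₂ (to T-∧ t)))))

  intervalsEndingAt-∉ : ∀ {m} → m ∉ intervalEnds bs → intervalsEndingAt m ≡ 0
  intervalsEndingAt-∉ {m} m∉ with intervalsEndingAt m in eq
  ... | zero  = refl
  ... | suc _
    with countᵇ-pos⇒∈ (λ B → isInterval B ∧ (proj₂ B ≡ᵇ m)) bs (subst (1 ≤_) (sym eq) (s≤s z≤n))
  ...   | B , B∈ , t = let iB , endsB = to T-∧ t in
                       ⊥-elim (m∉ (subst (_∈ intervalEnds bs) (≡ᵇ⇒≡ _ m endsB) (∈-intervalEnds⁺ B∈ iB)))

Int-criterion : ∀ {k} (ρ : NCmton (suc k)) → InsertionCriterion Int 0 1 0 ρ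
Int-criterion {k} ρ = record
  { positions         = intervalEnds bs
  ; positions-unique  = AllPairsₚ.map⁺ (AllPairsₚ.filter⁺ (T? ∘ isInterval) (rightEnds-distinct v))
  ; positions-inRange = All.tabulate rightEnd-inRange
  ; Z-at              = Int-at
  ; Z-off             = Int-off
  ; length-positions  = trans (length-intervalEnds bs) (sym (+-identityʳ _))
  }
  where
  open Insertions ρ
  bs = toList (proj₁ ρ)
  v = isNCmton ρ
  open IsNCmton v

  Int-child : ∀ {m} (r : InRange (suc k) m) → Int _ (child r) + intervalsEndingAt v m ≡ Int _ ρ + 1
  Int-child {m} r = subst (λ cs → countᵇ isInterval cs + intervalsEndingAt v m ≡ Int _ ρ + 1)
    (sym (toList-insertPair m (proj₁ ρ))) (Int-insertPair m bs (left<right v))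

  Int-at : ∀ {m} (r : InRange (suc k) m) → m ∈ intervalEnds bs → Int _ (child r) ≡ Int _ ρ + 0
  Int-at {m} r m∈ = begin
    Int _ (child r)                                ≡⟨ +-cancelʳ-≡ 1 _ _ (subst (λ e → Int _ (child r) + e ≡ Int _ ρ + 1)
                                                                               (intervalsEndingAt-∈ v m∈) (Int-child r)) ⟩
    Int _ ρ                                        ≡⟨ +-identityʳ _ ⟨
    Int _ ρ + 0                                    ∎
    where open ≡-Reasoning

  Int-off : ∀ {m} (r : InRange (suc k) m) → m ∉ intervalEnds bs → Int _ (child r) ≡ Int _ ρ + 1
  Int-off {m} r m∉ = begin
    Int _ (child r)                                ≡⟨ +-identityʳ _ ⟨
    Int _ (child r) + 0                            ≡⟨ cong (Int _ (child r) +_) (intervalsEndingAt-∉ v m∉) ⟨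
    Int _ (child r) + intervalsEndingAt v m        ≡⟨ Int-child r ⟩
    Int _ ρ + 1                                    ∎
    where open ≡-Reasoning

  rightEnd-inRange : ∀ {m} → m ∈ intervalEnds bs → InRange (suc k) m
  rightEnd-inRange m∈ with ∈-intervalEnds⁻ m∈
  ... | (a , b) , B∈ , _ , refl =
    let 1≤b , b≤ = containsᵇ⇒inRange v b B∈ (containsᵇ-right a b) in 1≤b , m≤n⇒m≤1+n b≤

module _ {A : Set} where

  any-++ : ∀ (p : A → Bool) xs ys → any p (xs ++ ys) ≡ any p xs ∨ any p ys
  any-++ p []       ys = refl
  any-++ p (x ∷ xs) ys = trans (cong (p x ∨_) (any-++ p xs ys)) (sym (∨-assoc (p x) _ _))

  any-map : ∀ {B : Set} (p : B → Bool) (f : A → B) xs → any p (List.map f xs) ≡ any (p ∘ f) xs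
  any-map p f []       = refl
  any-map p f (x ∷ xs) = cong (p (f x) ∨_) (any-map p f xs)

  any-cong : ∀ {p q : A → Bool} xs → (∀ {x} → x ∈ xs → p x ≡ q x) → any p xs ≡ any q xs
  any-cong []       p≗q = refl
  any-cong (x ∷ xs) p≗q = cong₂ _∨_ (p≗q (here refl)) (any-cong xs (p≗q ∘ there))

  T-any⇔ : ∀ (p : A → Bool) xs → T (any p xs) ⇔ (∃[ x ] (x ∈ xs × T (p x)))
  T-any⇔ p xs = mk⇔ (find ∘ any⁻ p xs) (λ (x , x∈ , px) → any⁺ p (lose x∈ px))

isOuterIn : List Block → Block → Bool
isOuterIn bs V = not (any (λ W → nestedᵇ V W) bs)

isOuterIn⇔ : ∀ bs B → T (isOuterIn bs B) ⇔ (∀ {W} → W ∈ bs → ¬ T (nestedᵇ B W))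
isOuterIn⇔ bs B = mk⇔ decode encode
  where
  decode : T (isOuterIn bs B) → ∀ {W} → W ∈ bs → ¬ T (nestedᵇ B W)
  decode t W∈ n = to T-not⇔ t (from (T-any⇔ (nestedᵇ B) bs) (_ , W∈ , n))
  encode : (∀ {W} → W ∈ bs → ¬ T (nestedᵇ B W)) → T (isOuterIn bs B)
  encode ¬n = from T-not⇔ λ t → let W , W∈ , n = to (T-any⇔ (nestedᵇ B) bs) t in ¬n W∈ n

coversGap : List Block → ℕ → Bool
coversGap bs m = any (λ W → nestedᵇ (pairAt m) (φᴮ m W)) bs

nestedᵇ-pairAt-φᴮ⇔ : ∀ m c d → T (nestedᵇ (pairAt m) (φᴮ m (c , d))) ⇔ (c < m × m ≤ d)
nestedᵇ-pairAt-φᴮ⇔ m c d = mk⇔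
  (λ t → let φc<m , m<φd = to nestedᵇ⇔ t in φ<⇒< φc<m , <φ⇒≤ m<φd)
  (λ (c<m , m≤d) → from nestedᵇ⇔
    (subst (_< m) (sym (φ-< c<m)) c<m , subst (suc m <_) (sym (φ-≥ m≤d)) (s≤s (s≤s m≤d))))
  where
  φ<⇒< : φ m c < m → c < m
  φ<⇒< φc<m with c <? m
  ... | yes c<m = c<m
  ... | no  c≮m = ⊥-elim (<-asym φc<m (subst (m <_) (sym (φ-≥ (≮⇒≥ c≮m))) (s≤s (m≤n⇒m≤1+n (≮⇒≥ c≮m)))))
  <φ⇒≤ : suc m < φ m d → m ≤ d
  <φ⇒≤ m<φd with d <? m
  ... | yes d<m = ⊥-elim (<-asym (<-trans (subst (_< m) (sym (φ-< d<m)) d<m) (n<1+n m)) m<φd)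
  ... | no  d≮m = ≮⇒≥ d≮m

coversGap⇔ : ∀ bs m → T (coversGap bs m) ⇔ (∃[ W ] (W ∈ bs × proj₁ W < m × m ≤ proj₂ W))
coversGap⇔ bs m = mk⇔
  (λ t → let (c , d) , W∈ , n = to (T-any⇔ (λ W → nestedᵇ (pairAt m) (φᴮ m W)) bs) t in
         (c , d) , W∈ , to (nestedᵇ-pairAt-φᴮ⇔ m c d) n)
  (λ ((c , d) , W∈ , c<m , m≤d) → from (T-any⇔ (λ W → nestedᵇ (pairAt m) (φᴮ m W)) bs)
                                    ((c , d) , W∈ , from (nestedᵇ-pairAt-φᴮ⇔ m c d) (c<m , m≤d)))

Out-insertPair : ∀ m bs → (∀ {B} → B ∈ bs → proj₁ B < proj₂ B) →
  countᵇ (isOuterIn (insertPairᴸ m bs)) (insertPairᴸ m bs)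
  ≡ countᵇ (isOuterIn bs) bs + (if not (coversGap bs m) then 1 else 0)
Out-insertPair m bs a<b = begin
  countᵇ (isOuterIn bs′) bs′
    ≡⟨ countᵇ-++ (isOuterIn bs′) (List.map (φᴮ m) bs) _ ⟩
  countᵇ (isOuterIn bs′) (List.map (φᴮ m) bs) + countᵇ (isOuterIn bs′) [ pairAt m ]
    ≡⟨ cong₂ _+_ (countᵇ-map (isOuterIn bs′) (φᴮ m) bs) (+-identityʳ _) ⟩
  countᵇ (isOuterIn bs′ ∘ φᴮ m) bs + (if isOuterIn bs′ (pairAt m) then 1 else 0)
    ≡⟨ cong₂ (λ c b → c + (if b then 1 else 0)) (countᵇ-cong bs old-outer) new-outer ⟩
  countᵇ (isOuterIn bs) bs + (if not (coversGap bs m) then 1 else 0) ∎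
  where
  open ≡-Reasoning
  bs′ = insertPairᴸ m bs

  old-outer : ∀ {B} → B ∈ bs → isOuterIn bs′ (φᴮ m B) ≡ isOuterIn bs B
  old-outer {B} B∈ = cong not (begin
    any (nestedᵇ (φᴮ m B)) bs′
      ≡⟨ any-++ (nestedᵇ (φᴮ m B)) (List.map (φᴮ m) bs) _ ⟩
    any (nestedᵇ (φᴮ m B)) (List.map (φᴮ m) bs) ∨ (nestedᵇ (φᴮ m B) (pairAt m) ∨ false)
      ≡⟨ cong₂ _∨_ (trans (any-map _ (φᴮ m) bs) (any-cong bs (λ {W} _ → nestedᵇ-φᴮ m B W)))
                   (cong (_∨ false) (to T-not-≡ (from T-not⇔ (¬nestedᵇ-pairAt m (φ-mono-< m (a<b B∈)))))) ⟩
    any (nestedᵇ B) bs ∨ false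
      ≡⟨ ∨-identityʳ _ ⟩
    any (nestedᵇ B) bs ∎)

  new-outer : isOuterIn bs′ (pairAt m) ≡ not (coversGap bs m)
  new-outer = cong not (begin
    any (nestedᵇ (pairAt m)) bs′
      ≡⟨ any-++ (nestedᵇ (pairAt m)) (List.map (φᴮ m) bs) _ ⟩
    any (nestedᵇ (pairAt m)) (List.map (φᴮ m) bs) ∨ (nestedᵇ (pairAt m) (pairAt m) ∨ false)
      ≡⟨ cong₂ _∨_ (any-map _ (φᴮ m) bs)
                   (cong (_∨ false) (to T-not-≡ (from T-not⇔ (nestedᵇ-irrefl (pairAt m))))) ⟩
    coversGap bs m ∨ false
      ≡⟨ ∨-identityʳ _ ⟩
    coversGap bs m ∎)

outerEnds : List Block → List ℕ
outerEnds bs = 1 ∷ List.map (suc ∘ proj₂) (filter (T? ∘ isOuterIn bs) bs)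

module _ {n} {bs : List Block} (v : IsNCmton n bs) where
  open IsNCmton v

  ∈-outerEnds⁺ : ∀ {B} → B ∈ bs → T (isOuterIn bs B) → suc (proj₂ B) ∈ outerEnds bs
  ∈-outerEnds⁺ B∈ oB = there (∈-map⁺ (suc ∘ proj₂) (∈-filter⁺ (T? ∘ isOuterIn bs) B∈ oB))

  outerEnds-unique : Unique (outerEnds bs)
  outerEnds-unique =
    All.tabulate 1∉ ∷
    AllPairsₚ.map⁺ (AllPairsₚ.filter⁺ _ (AllPairs.map (_∘ suc-injective) (rightEnds-distinct v)))
    where
    1∉ : ∀ {m} → m ∈ List.map (suc ∘ proj₂) (filter (T? ∘ isOuterIn bs) bs) → 1 ≢ m
    1∉ m∈ 1≡m with ∈-map⁻ (suc ∘ proj₂) m∈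
    ... | (a , b) , B∈ , refl =
      let 1≤a , a<b , _ = wellFormed (proj₁ (∈-filter⁻ (T? ∘ isOuterIn bs) B∈)) in
      <-irrefl refl (subst (0 <_) (sym (suc-injective 1≡m)) (≤-trans 1≤a (<⇒≤ a<b)))

  outerEnds-inRange : All (InRange n) (outerEnds bs)
  outerEnds-inRange = (s≤s z≤n , s≤s z≤n) ∷ All.tabulate inRange
    where
    inRange : ∀ {m} → m ∈ List.map (suc ∘ proj₂) (filter (T? ∘ isOuterIn bs) bs) → InRange n m
    inRange m∈ with ∈-map⁻ (suc ∘ proj₂) m∈
    ... | (a , b) , B∈ , refl =
      s≤s z≤n , s≤s (proj₂ (proj₂ (wellFormed (proj₁ (∈-filter⁻ (T? ∘ isOuterIn bs) B∈)))))

  length-outerEnds : length (outerEnds bs) ≡ countᵇ (isOuterIn bs) bs + 1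
  length-outerEnds = trans
    (cong suc (trans (length-map (suc ∘ proj₂) (filter (T? ∘ isOuterIn bs) bs))
                     (sym (countᵇ≡length-filter (isOuterIn bs) bs))))
    (+-comm 1 _)

  outerEnds-uncovered : ∀ {m} → m ∈ outerEnds bs → ¬ T (coversGap bs m)
  outerEnds-uncovered (here refl) t with to (coversGap⇔ bs 1) t
  ... | W , W∈ , c<1 , _ = <⇒≱ c<1 (proj₁ (wellFormed W∈))
  outerEnds-uncovered {m} (there m∈) t with ∈-map⁻ (suc ∘ proj₂) m∈ | to (coversGap⇔ bs m) t
  ... | (p , q) , B∈f , refl | (c , d) , W∈ , s≤s c≤q , q<d
    with ∈-filter⁻ (T? ∘ isOuterIn bs) {xs = bs} B∈f | m≤n⇒m<n∨m≡n c≤q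
  ...   | B∈ , outer | inj₁ c<q =
    to (isOuterIn⇔ bs (p , q)) outer W∈ (inside⇒nested v B∈ W∈ (containsᵇ-right p q) c<q q<d)
  ...   | B∈ , _     | inj₂ c≡q =
    <-irrefl (cong proj₂ (sharedPoint⇒≡ v q B∈ W∈ (containsᵇ-right p q) (from (containsᵇ⇔ q c d) (inj₁ (sym c≡q))))) q<d

  -- The block of the point m - 1 ends there, as it would cover the gap otherwise, and it is
  -- outer, as its parent would cover the gap otherwise.
  uncovered⇒outerEnds : ∀ {m} → InRange n m → ¬ T (coversGap bs m) → m ∈ outerEnds bs
  uncovered⇒outerEnds {suc zero}    _        _    = here refl
  uncovered⇒outerEnds {suc (suc y)} (_ , m≤) ¬cov
    with countᵇ-pos⇒∈ (containsᵇ (suc y)) bs (≤-reflexive (sym (covers (s≤s z≤n) (≤-pred m≤))))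
  ... | (p , q) , B∈ , yB with to (containsᵇ⇔ (suc y) p q) yB
  ...   | inj₁ refl = ⊥-elim (¬cov (from (coversGap⇔ bs _) ((suc y , q) , B∈ , n<1+n _ , left<right v B∈)))
  ...   | inj₂ refl = ∈-outerEnds⁺ B∈ (from (isOuterIn⇔ bs (p , suc y)) ¬nested)
    where
    ¬nested : ∀ {W} → W ∈ bs → ¬ T (nestedᵇ (p , suc y) W)
    ¬nested {c , d} W∈ nest =
      let c<p , sy<d = to nestedᵇ⇔ nest in
      ¬cov (from (coversGap⇔ bs _) ((c , d) , W∈ , <-trans (<-trans c<p (left<right v B∈)) (n<1+n _) , sy<d))

  ∉outerEnds⇒covered : ∀ {m} → InRange n m → m ∉ outerEnds bs → coversGap bs m ≡ true
  ∉outerEnds⇒covered {m} r m∉ with coversGap bs m in eq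
  ... | true  = refl
  ... | false = ⊥-elim (m∉ (uncovered⇒outerEnds r (subst T eq)))

Out-criterion : ∀ {k} (ρ : NCmton (suc k)) → InsertionCriterion Out 1 0 1 ρ
Out-criterion {k} ρ = record
  { positions         = outerEnds bs
  ; positions-unique  = outerEnds-unique v
  ; positions-inRange = outerEnds-inRange v
  ; Z-at              = λ r m∈ → trans (Out-child r) (cong (λ b → Out _ ρ + (if not b then 1 else 0))
                                                          (to T-not-≡ (from T-not⇔ (outerEnds-uncovered v m∈))))
  ; Z-off             = λ r m∉ → trans (Out-child r) (cong (λ b → Out _ ρ + (if not b then 1 else 0))
                                                          (∉outerEnds⇒covered v r m∉))
  ; length-positions  = length-outerEnds v
  }
  where
  open Insertions ρ
  bs = toList (proj₁ ρ)
  v = isNCmton ρ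

  Out-child : ∀ {m} (r : InRange (suc k) m) → Out _ (child r) ≡ Out _ ρ + (if not (coversGap bs m) then 1 else 0)
  Out-child {m} r = subst (λ cs → countᵇ (isOuterIn cs) cs ≡ Out _ ρ + (if not (coversGap bs m) then 1 else 0))
    (sym (toList-insertPair m (proj₁ ρ))) (Out-insertPair m bs (left<right v))

lemma7p9 : PairRecursive2 Int 0 1 0 × PairRecursive2 Out 1 0 1
lemma7p9 = pairRecursive2-intro Int-criterion , pairRecursive2-intro Out-criterion
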